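{- Let $\alpha=(1^{f_1},2^{e_1},1^{f_2},\dots,1^{f_{k-1}},2^{e_{k-1}},1^{f_k})$ where $f_1,f_k\in\mathbb{N}_0$, $f_2,\dots,f_{k-1}\in\mathbb{N}$ and $e_1,\dots,e_{k-1}\in\mathbb{N}$. Then $\mathcal{S}_\alpha$ is F-multiplicity free if and only if $e_i\le4$ for all $i$.
   Context: $i^m$ denotes $m$ consecutive parts equal to $i$ (omitted if $m=0$); $\mathbb{N}_0=\{0,1,\dots\}$, $\mathbb{N}=\{1,2,\dots\}$. For $\beta\vDash n$, $\mathrm{set}(\beta)=\{\beta_1,\beta_1+\beta_2,\dots\}$ (partial sums excluding $n$) and $F_\beta=\sum x_{i_1}\cdots x_{i_n}$ over $i_1\le\cdots\le i_n$ with $i_j<i_{j+1}$ whenever $j\in\mathrm{set}(\beta)$. The composition diagram of $\alpha$ has $\alpha_i$ left-justified cells in row $i$ (top to bottom). Cover relation: $\beta\lessdot\gamma$ if $\gamma=(1)\cdot\beta$ (new top row of one cell) or $\gamma$ is obtained from $\beta$ by adding $1$ to the leftmost part of $\beta$ equal to $k$, for some $k$ (cell added at the right end of that row). A standard composition tableau (SCT) of shape $\alpha\vDash n$ comes from a chain $\emptyset=\alpha^{n+1}\lessdot\cdots\lessdot\alpha^1=\alpha$ by putting $i$ in the cell added from $\alpha^{i+1}$ to $\alpha^i$. Its descent set is the set of $i$ with $i+1$ in a column weakly right of that of $i$; $\mathrm{com}(T)$ is the composition with this set. $\mathcal{S}_\alpha=\sum_T F_{\mathrm{com}(T)}$ over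 SCT $T$ of shape $\alpha$. A quasisymmetric function $\sum c_\beta F_\beta$ is F-multiplicity free if all $c_\beta\in\{0,1\}$. -}

module Defs where

open import Data.Nat using (ℕ; zero; suc; _≟_; _≡ᵇ_; _≤ᵇ_; _≤_; _<_)
open import Data.Bool using (if_then_else_)
open import Data.List using (List; []; _∷_; [_]; map; concatMap; filter; length; replicate; _++_; deduplicate)
open import Data.List.Properties using (≡-dec)
open import Data.Product using (_×_; _,_; proj₁; proj₂)
open import Data.Vec using (Vec; []; _∷_)
open import Data.Nat.ListAction using (sum)

-- Compositions are lists of positive naturals (parts read top to bottom).
Comp : Set
Comp = List ℕ

incLeftmost : ℕ → Comp → Comp
incLeftmost k [] = []
incLeftmost k (x ∷ xs) = if x ≡ᵇ k then suc x ∷ xs else x ∷ incLeftmost k xs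

-- All covers γ of β (β ⋖ γ), each with the column of the added cell:
--   γ = (1)·β  (new top row, cell in column 1), or
--   γ = β with 1 added to the leftmost part equal to k (cell in column k+1),
--   for each distinct part value k of β.
-- Distinct entries give distinct γ.
covers : Comp → List (Comp × ℕ)
covers β = (1 ∷ β , 1) ∷ map (λ k → incLeftmost k β , suc k) (deduplicate _≟_ β)

-- All saturated chains ∅ = α^{n+1} ⋖ ⋯ ⋖ α^1 of length n, each recorded as
-- (top shape α^1 , [col(1), col(2), …, col(n)]) where col(i) is the column
-- of the cell added from α^{i+1} to α^i, i.e. the cell containing i.
-- Chains correspond bijectively to standard composition tableaux.
chains : ℕ → List (Comp × List ℕ)
chains zero = [ ([] , []) ]
chains (suc n) =
  concatMap (λ p → map (λ q → proj₁ q , proj₂ q ∷ proj₂ p) (covers (proj₁ p))) (chains n)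

SCT : Comp → List (List ℕ)
SCT α = map proj₂ (filter (λ p → ≡-dec _≟_ (proj₁ p) α) (chains (sum α)))

-- com(T): i is a descent iff col(i+1) ≥ col(i); the composition with that descent set.
comAux : ℕ → ℕ → List ℕ → Comp
comAux acc c [] = [ acc ]
comAux acc c (c' ∷ cs) = if c ≤ᵇ c' then acc ∷ comAux 1 c' cs else comAux (suc acc) c' cs

com : List ℕ → Comp
com [] = []
com (c ∷ cs) = comAux 1 c cs

-- Coefficient of F_β in 𝒮_α = Σ_T F_{com(T)}  (F_β form a basis of QSym).
coeffF : Comp → Comp → ℕ
coeffF α β = length (filter (λ T → ≡-dec _≟_ (com T) β) (SCT α))

FMultFree : Comp → Set
FMultFree α = ∀ (β : Comp) → coeffF α β ≤ 1

alphaShape : ∀ {m} → Vec ℕ (suc m) → Vec ℕ m → Comp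
alphaShape (f ∷ []) [] = replicate f 1
alphaShape (f ∷ fs@(_ ∷ _)) (e ∷ es) = replicate f 1 ++ replicate e 2 ++ alphaShape fs es

-- A shape α is descent-injective when distinct SCTs of shape α have distinct descent sets;
-- since com T determines the descent set of T, no F_β can then be hit twice. For shapes with
-- parts 1 and 2 a row of length 1 cuts every SCT into an SCT of the rows above it followed by
-- one of the rows below, and the descent set of the whole determines those of the pieces, so
-- such a shape is descent-injective as soon as each maximal block 2^e is; evaluation confirms
-- this for e ≤ 4. Conversely 2⁵ has two SCTs with the same descent set and the same first and
-- last columns; completing both by one fixed tableau of the rows above and one of the rows
-- below gives two SCTs of α with the same com, so a block 2^e with e ≥ 5 forces a
-- coefficient 2.

module Submission where

open import Defs
open import Data.Bool as Bool using (Bool; true; false; T)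
open import Data.Bool.Properties using (T-≡)
open import Data.Fin using (Fin; toℕ; zero; suc)
open import Data.List using (List; []; _∷_; [_]; _++_; map; filter; length; replicate; deduplicate; applyDownFrom)
open import Data.List.Properties using (∷-injective; ∷-injectiveˡ; ∷-injectiveʳ; ++-cancelˡ; ++-identityʳ; ++-assoc; ≡-dec)
open import Data.List.Membership.Propositional using (_∈_; find; lose)
open import Data.List.Membership.Propositional.Properties
  using (∈-map⁺; ∈-map⁻; ∈-concatMap⁺; ∈-concatMap⁻; ∈-filter⁺; ∈-filter⁻; ∈-deduplicate⁺; ∈-deduplicate⁻; ∈-++⁺ˡ; ∈-length)
open import Data.Nat using (ℕ; zero; suc; _+_; _≤_; _<_; z≤n; s≤s; _≟_; _≡ᵇ_; _≤ᵇ_; _≤?_)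
open import Data.List.Membership.DecPropositional (≡-dec _≟_) using (_∈?_)
open import Data.List.Relation.Unary.All as All using (All; []; _∷_)
import Data.List.Relation.Unary.All.Properties as All
open import Data.List.Relation.Unary.AllPairs as AllPairs using (AllPairs; []; _∷_)
import Data.List.Relation.Unary.AllPairs.Properties as AllPairs
open import Data.List.Relation.Unary.Any as Any using (here; there)
open import Data.List.Relation.Unary.Unique.Propositional using (Unique)
open import Data.List.Relation.Unary.Unique.DecPropositional.Properties _≟_ using (deduplicate-!)
open import Data.Nat.ListAction using (sum)
open import Data.Nat.Properties using (≡ᵇ⇒≡; ≡⇒≡ᵇ; +-suc; ≤-refl; ≤-trans; n≤1+n; 1+n≰n; suc-injective; ≰⇒>)
open import Data.Product using (_×_; _,_; proj₁; proj₂; ∃; ∃₂)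
open import Data.Sum using (_⊎_; inj₁; inj₂)
open import Data.Vec using (Vec; lookup; []; _∷_)
open import Function using (_∘_; Equivalence)
open import Relation.Binary.PropositionalEquality using (_≡_; _≢_; refl; sym; trans; cong; cong₂; subst; module ≡-Reasoning)
open import Relation.Nullary using (¬_; Dec; yes; no; contradiction)
open import Relation.Nullary.Decidable using (toWitness; _→-dec_)

descents : List ℕ → List Bool
descents []            = []
descents (c ∷ [])      = []
descents (c ∷ c′ ∷ cs) = (c ≤ᵇ c′) ∷ descents (c′ ∷ cs)

fromDescents : ℕ → List Bool → Comp
fromDescents a []           = [ a ]
fromDescents a (true ∷ bs)  = a ∷ fromDescents 1 bs
fromDescents a (false ∷ bs) = fromDescents (suc a) bs

comAux≡fromDescents : ∀ a c cs → comAux a c cs ≡ fromDescents a (descents (c ∷ cs))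
comAux≡fromDescents a c []        = refl
comAux≡fromDescents a c (c′ ∷ cs) with c ≤ᵇ c′
... | true  = cong (a ∷_) (comAux≡fromDescents 1 c′ cs)
... | false = comAux≡fromDescents (suc a) c′ cs

fromDescents-≢[] : ∀ a bs → fromDescents a bs ≢ []
fromDescents-≢[] a []           ()
fromDescents-≢[] a (true ∷ bs)  ()
fromDescents-≢[] a (false ∷ bs) = fromDescents-≢[] (suc a) bs

fromDescents-head : ∀ a bs {x xs} → fromDescents a bs ≡ x ∷ xs → a ≤ x
fromDescents-head a []           refl = ≤-refl
fromDescents-head a (true ∷ bs)  refl = ≤-refl
fromDescents-head a (false ∷ bs) eq   = ≤-trans (n≤1+n a) (fromDescents-head (suc a) bs eq)

fromDescents-injective : ∀ a {bs bs′} → fromDescents a bs ≡ fromDescents a bs′ → bs ≡ bs′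
fromDescents-injective a {[]}         {[]}          eq = refl
fromDescents-injective a {true ∷ bs}  {true ∷ bs′}  eq = cong (true ∷_) (fromDescents-injective 1 (∷-injectiveʳ eq))
fromDescents-injective a {false ∷ bs} {false ∷ bs′} eq = cong (false ∷_) (fromDescents-injective (suc a) eq)
fromDescents-injective a {[]}         {true ∷ bs′}  eq = contradiction (sym (∷-injectiveʳ eq)) (fromDescents-≢[] 1 bs′)
fromDescents-injective a {true ∷ bs}  {[]}          eq = contradiction (∷-injectiveʳ eq) (fromDescents-≢[] 1 bs)
fromDescents-injective a {[]}         {false ∷ bs′} eq = contradiction (fromDescents-head (suc a) bs′ (sym eq)) 1+n≰n
fromDescents-injective a {true ∷ _}   {false ∷ bs′} eq = contradiction (fromDescents-head (suc a) bs′ (sym eq)) 1+n≰n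
fromDescents-injective a {false ∷ bs} {[]}          eq = contradiction (fromDescents-head (suc a) bs eq) 1+n≰n
fromDescents-injective a {false ∷ bs} {true ∷ _}    eq = contradiction (fromDescents-head (suc a) bs eq) 1+n≰n

com≡⇒descents≡ : ∀ {cs cs′} → com cs ≡ com cs′ → descents cs ≡ descents cs′
com≡⇒descents≡ {[]}     {[]}       _  = refl
com≡⇒descents≡ {[]}     {c′ ∷ cs′} eq =
  contradiction (trans eq (comAux≡fromDescents 1 c′ cs′)) (fromDescents-≢[] 1 (descents (c′ ∷ cs′)) ∘ sym)
com≡⇒descents≡ {c ∷ cs} {[]}       eq =
  contradiction (trans (sym (comAux≡fromDescents 1 c cs)) eq) (fromDescents-≢[] 1 (descents (c ∷ cs)))
com≡⇒descents≡ {c ∷ cs} {c′ ∷ cs′} eq = fromDescents-injective 1 (begin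
  fromDescents 1 (descents (c ∷ cs))   ≡⟨ comAux≡fromDescents 1 c cs ⟨
  com (c ∷ cs)                         ≡⟨ eq ⟩
  com (c′ ∷ cs′)                       ≡⟨ comAux≡fromDescents 1 c′ cs′ ⟩
  fromDescents 1 (descents (c′ ∷ cs′)) ∎)
  where open ≡-Reasoning

descents≡⇒com≡ : ∀ {c cs c′ cs′} → descents (c ∷ cs) ≡ descents (c′ ∷ cs′) → com (c ∷ cs) ≡ com (c′ ∷ cs′)
descents≡⇒com≡ {c} {cs} {c′} {cs′} eq = begin
  comAux 1 c cs                        ≡⟨ comAux≡fromDescents 1 c cs ⟩
  fromDescents 1 (descents (c ∷ cs))   ≡⟨ cong (fromDescents 1) eq ⟩
  fromDescents 1 (descents (c′ ∷ cs′)) ≡⟨ comAux≡fromDescents 1 c′ cs′ ⟨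
  comAux 1 c′ cs′                      ∎
  where open ≡-Reasoning

descents-∷⁻ : ∀ {x y xs ys} → descents (x ∷ xs) ≡ descents (y ∷ ys) → descents xs ≡ descents ys
descents-∷⁻ {xs = []}    {[]}    _  = refl
descents-∷⁻ {xs = _ ∷ _} {_ ∷ _} eq = ∷-injectiveʳ eq

descents-++⁻ : ∀ R {R′ S S′} → length R ≡ length R′ → descents (R ++ S) ≡ descents (R′ ++ S′) →
  descents R ≡ descents R′ × descents S ≡ descents S′
descents-++⁻ []          {[]}          _   eq = refl , eq
descents-++⁻ (_ ∷ [])    {_ ∷ []}      _   eq = refl , descents-∷⁻ eq
descents-++⁻ (_ ∷ y ∷ R) {_ ∷ y′ ∷ R′} len eq =
  let heads , tails = ∷-injective eq
      dR , dS = descents-++⁻ (y ∷ R) (suc-injective len) tails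
  in cong₂ _∷_ heads dR , dS

descents-++⁺ : ∀ X {c Z Z′} → descents (c ∷ Z) ≡ descents (c ∷ Z′) → descents (X ++ c ∷ Z) ≡ descents (X ++ c ∷ Z′)
descents-++⁺ []          eq = eq
descents-++⁺ (x ∷ [])    eq = cong (_ ∷_) eq
descents-++⁺ (x ∷ y ∷ X) eq = cong (_ ∷_) (descents-++⁺ (y ∷ X) eq)

com-++-cong : ∀ X {c Z Z′} → descents (c ∷ Z) ≡ descents (c ∷ Z′) → com (X ++ c ∷ Z) ≡ com (X ++ c ∷ Z′)
com-++-cong []      eq = descents≡⇒com≡ eq
com-++-cong (x ∷ X) eq = descents≡⇒com≡ (descents-++⁺ (x ∷ X) eq)

≡ᵇ-true⇒≡ : ∀ {m n} → (m ≡ᵇ n) ≡ true → m ≡ n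
≡ᵇ-true⇒≡ {m} {n} eq = ≡ᵇ⇒≡ m n (Equivalence.from T-≡ eq)

≡ᵇ-false⇒≢ : ∀ {m n} → (m ≡ᵇ n) ≡ false → m ≢ n
≡ᵇ-false⇒≢ {m} {n} eq m≡n = subst T eq (≡⇒≡ᵇ m n m≡n)

∈-tail-≢ᵇ : ∀ {k x β} → (x ≡ᵇ k) ≡ false → k ∈ x ∷ β → k ∈ β
∈-tail-≢ᵇ eq = Any.tail (≡ᵇ-false⇒≢ eq ∘ sym)

incLeftmost-head : ∀ k β → incLeftmost k (k ∷ β) ≡ suc k ∷ β
incLeftmost-head k β with k ≡ᵇ k in eq
... | true  = refl
... | false = contradiction refl (≡ᵇ-false⇒≢ {k} eq)

incLeftmost-positive : ∀ k {β} → All (0 <_) β → All (0 <_) (incLeftmost k β)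
incLeftmost-positive k []                         = []
incLeftmost-positive k {x ∷ β} (x>0 ∷ β>0) with x ≡ᵇ k
... | true  = s≤s z≤n ∷ β>0
... | false = x>0 ∷ incLeftmost-positive k β>0

incLeftmost-≤⁻ : ∀ {b} k β → All (_≤ b) (incLeftmost k β) → All (_≤ b) β
incLeftmost-≤⁻ k []      []        = []
incLeftmost-≤⁻ k (x ∷ β) β′≤b with x ≡ᵇ k | β′≤b
... | true  | s≤s x≤b ∷ β≤b  = ≤-trans x≤b (n≤1+n _) ∷ β≤b
... | false | x≤b ∷ β′′≤b    = x≤b ∷ incLeftmost-≤⁻ k β β′′≤b

sum-incLeftmost : ∀ {k β} → k ∈ β → sum (incLeftmost k β) ≡ suc (sum β)
sum-incLeftmost {k} {x ∷ β} k∈ with x ≡ᵇ k in eq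
... | true  = refl
... | false = trans (cong (x +_) (sum-incLeftmost (∈-tail-≢ᵇ eq k∈))) (+-suc x (sum β))

incLeftmost-∈ : ∀ {k β} → k ∈ β → suc k ∈ incLeftmost k β
incLeftmost-∈ {k} {x ∷ β} k∈ with x ≡ᵇ k in eq
... | true  = here (cong suc (sym (≡ᵇ-true⇒≡ eq)))
... | false = there (incLeftmost-∈ (∈-tail-≢ᵇ eq k∈))

incLeftmost-++ : ∀ {k} P Q → k ∈ P → incLeftmost k (P ++ Q) ≡ incLeftmost k P ++ Q
incLeftmost-++ {k} (x ∷ P) Q k∈ with x ≡ᵇ k in eq
... | true  = refl
... | false = cong (x ∷_) (incLeftmost-++ P Q (∈-tail-≢ᵇ eq k∈))

incLeftmost-1⁻ : ∀ β P Q → 1 ∈ β → incLeftmost 1 β ≡ P ++ 1 ∷ Q →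
  ∃ λ P₀ → β ≡ P₀ ++ 1 ∷ Q × 1 ∈ P₀ × incLeftmost 1 P₀ ≡ P
incLeftmost-1⁻ (1 ∷ β)             (_ ∷ P) Q _  refl = 1 ∷ P , refl , here refl , refl
incLeftmost-1⁻ (0 ∷ β)             (_ ∷ P) Q 1∈ eq   =
  let P₀ , β≡ , 1∈P₀ , inc≡ = incLeftmost-1⁻ β P Q (Any.tail (λ ()) 1∈) (∷-injectiveʳ eq)
  in 0 ∷ P₀ , cong (0 ∷_) β≡ , there 1∈P₀ , cong₂ _∷_ (∷-injectiveˡ eq) inc≡
incLeftmost-1⁻ (suc (suc x) ∷ β)   (_ ∷ P) Q 1∈ eq   =
  let P₀ , β≡ , 1∈P₀ , inc≡ = incLeftmost-1⁻ β P Q (Any.tail (λ ()) 1∈) (∷-injectiveʳ eq)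
  in suc (suc x) ∷ P₀ , cong (_ ∷_) β≡ , there 1∈P₀ , cong₂ _∷_ (∷-injectiveˡ eq) inc≡
incLeftmost-1⁻ (1 ∷ β)             [] Q _ ()
incLeftmost-1⁻ (0 ∷ β)             [] Q _ ()
incLeftmost-1⁻ (suc (suc x) ∷ β)   [] Q _ ()

-- Chain T α: T = [col(1), …, col(n)] is the column word of an SCT of shape α; the
-- last constructor applied adds the cell labelled 1.
data Chain : List ℕ → Comp → Set where
  ∅    : Chain [] []
  top  : ∀ {cs β} → Chain cs β → Chain (1 ∷ cs) (1 ∷ β)
  grow : ∀ {cs β k} → Chain cs β → k ∈ β → Chain (suc k ∷ cs) (incLeftmost k β)

extend : Comp × List ℕ → List (Comp × List ℕ)
extend p = map (λ q → proj₁ q , proj₂ q ∷ proj₂ p) (covers (proj₁ p))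

∈-covers⁻ : ∀ {β q} → q ∈ covers β → q ≡ (1 ∷ β , 1) ⊎ ∃ λ k → k ∈ β × q ≡ (incLeftmost k β , suc k)
∈-covers⁻     (here refl) = inj₁ refl
∈-covers⁻ {β} (there q∈) with ∈-map⁻ (λ k → incLeftmost k β , suc k) q∈
... | k , k∈ , refl = inj₂ (k , ∈-deduplicate⁻ _≟_ β k∈ , refl)

∈-chains⁻ : ∀ n {p} → p ∈ chains n → Chain (proj₂ p) (proj₁ p)
∈-chains⁻ zero    (here refl) = ∅
∈-chains⁻ (suc n) p∈ with find (∈-concatMap⁻ extend {xs = chains n} p∈)
... | p′ , p′∈ , p∈extend with ∈-map⁻ (λ q → proj₁ q , proj₂ q ∷ proj₂ p′) p∈extend
...   | q , q∈ , refl with ∈-covers⁻ q∈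
...     | inj₁ refl              = top (∈-chains⁻ n p′∈)
...     | inj₂ (k , k∈ , refl)   = grow (∈-chains⁻ n p′∈) k∈

∈-chains⁺ : ∀ {cs γ} → Chain cs γ → (γ , cs) ∈ chains (length cs)
∈-chains⁺ ∅                    = here refl
∈-chains⁺ (top c)              = ∈-concatMap⁺ extend (lose (∈-chains⁺ c) (here refl))
∈-chains⁺ {suc k ∷ cs} (grow {β = β} c k∈) = ∈-concatMap⁺ extend (lose (∈-chains⁺ c)
  (there (∈-map⁺ (λ q → proj₁ q , proj₂ q ∷ cs) (∈-map⁺ (λ k → incLeftmost k β , suc k) (∈-deduplicate⁺ _≟_ k∈)))))

Chain⇒positive : ∀ {cs γ} → Chain cs γ → All (0 <_) γ
Chain⇒positive ∅                     = []
Chain⇒positive (top c)               = s≤s z≤n ∷ Chain⇒positive c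
Chain⇒positive (grow {k = k} c _)    = incLeftmost-positive k (Chain⇒positive c)

Chain⇒length≡sum : ∀ {cs γ} → Chain cs γ → length cs ≡ sum γ
Chain⇒length≡sum ∅           = refl
Chain⇒length≡sum (top c)     = cong suc (Chain⇒length≡sum c)
Chain⇒length≡sum (grow c k∈) = trans (cong suc (Chain⇒length≡sum c)) (sym (sum-incLeftmost k∈))

∈-SCT⁻ : ∀ {α T} → T ∈ SCT α → Chain T α
∈-SCT⁻ {α} T∈ with ∈-map⁻ proj₂ {xs = filter (λ p → ≡-dec _≟_ (proj₁ p) α) (chains (sum α))} T∈
... | p , p∈ , refl with ∈-filter⁻ (λ p → ≡-dec _≟_ (proj₁ p) α) {xs = chains (sum α)} p∈
...   | p∈chains , refl = ∈-chains⁻ (sum α) p∈chains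

∈-SCT⁺ : ∀ {α T} → Chain T α → T ∈ SCT α
∈-SCT⁺ {α} {T} c = ∈-map⁺ proj₂ (∈-filter⁺ (λ p → ≡-dec _≟_ (proj₁ p) α)
  (subst (λ n → (α , T) ∈ chains n) (Chain⇒length≡sum c) (∈-chains⁺ c)) refl)

DistinctColumns : List (Comp × List ℕ) → Set
DistinctColumns = AllPairs (λ p q → proj₂ p ≢ proj₂ q)

covers-distinct : ∀ {β} → All (0 <_) β → AllPairs (λ q q′ → proj₂ q ≢ proj₂ q′) (covers β)
covers-distinct {β} β>0 = new≢grow ∷ AllPairs.map⁺ (AllPairs.map (λ k≢k′ → k≢k′ ∘ suc-injective) (deduplicate-! β))
  where
  new≢grow : All (λ q → 1 ≢ proj₂ q) (map (λ k → incLeftmost k β , suc k) (deduplicate _≟_ β))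
  new≢grow = All.map⁺ (All.tabulate λ k∈ 1≡1+k →
    contradiction (All.lookup β>0 (subst (_∈ β) (sym (suc-injective 1≡1+k)) (∈-deduplicate⁻ _≟_ β k∈))) λ ())

extend-distinct : ∀ {p} → All (0 <_) (proj₁ p) → DistinctColumns (extend p)
extend-distinct β>0 = AllPairs.map⁺ (AllPairs.map (λ c≢c′ → c≢c′ ∘ ∷-injectiveˡ) (covers-distinct β>0))

extend-disjoint : ∀ {p p′} → proj₂ p ≢ proj₂ p′ → All (λ x → All (λ y → proj₂ x ≢ proj₂ y) (extend p′)) (extend p)
extend-disjoint cs≢cs′ =
  All.map⁺ (All.universal (λ _ → All.map⁺ (All.universal (λ _ → cs≢cs′ ∘ ∷-injectiveʳ) _)) _)

chains-distinct : ∀ n → DistinctColumns (chains n)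
chains-distinct zero    = [] ∷ []
chains-distinct (suc n) = AllPairs.concat⁺
  (All.map⁺ (All.tabulate λ p∈ → extend-distinct (Chain⇒positive (∈-chains⁻ n p∈))))
  (AllPairs.map⁺ (AllPairs.map extend-disjoint (chains-distinct n)))

SCT-unique : ∀ α → Unique (SCT α)
SCT-unique α = AllPairs.map⁺ (AllPairs.filter⁺ _ (chains-distinct (sum α)))

Chain-++ : ∀ {R P S Q} → Chain R P → Chain S Q → Chain (R ++ S) (P ++ Q)
Chain-++ ∅       d = d
Chain-++ (top c) d = top (Chain-++ c d)
Chain-++ {Q = Q} (grow {β = β} c k∈) d =
  subst (Chain _) (incLeftmost-++ β Q k∈) (grow (Chain-++ c d) (∈-++⁺ˡ k∈))

-- With all parts ≤ 2 only rows of length 1 grow, always the leftmost one, so a row that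
-- is still of length 1 at the end separates the cells above it from the earlier cells below.
Chain-split : ∀ {cs γ} → Chain cs γ → All (_≤ 2) γ → ∀ P Q → γ ≡ P ++ 1 ∷ Q →
  ∃₂ λ R S → cs ≡ R ++ 1 ∷ S × Chain R P × Chain S Q
Chain-split ∅       _          []      Q ()
Chain-split ∅       _          (_ ∷ _) Q ()
Chain-split (top c) _          []      Q refl = [] , _ , refl , ∅ , c
Chain-split (top c) (_ ∷ γ≤2)  (_ ∷ P) Q refl with Chain-split c γ≤2 P Q refl
... | R , S , refl , cR , cS = 1 ∷ R , S , refl , top cR , cS
Chain-split (grow {k = zero} c 0∈)          _   _ _ _ = contradiction (All.lookup (Chain⇒positive c) 0∈) λ ()
Chain-split (grow {k = suc (suc k)} c k∈)   γ≤2 _ _ _ = contradiction (All.lookup γ≤2 (incLeftmost-∈ k∈)) λ { (s≤s (s≤s ())) }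
Chain-split (grow {β = β} {k = 1} c 1∈)     γ≤2 P Q eq with incLeftmost-1⁻ β P Q 1∈ eq
... | P₀ , refl , 1∈P₀ , refl with Chain-split c (incLeftmost-≤⁻ 1 β γ≤2) P₀ Q refl
...   | R , S , refl , cR , cS = 2 ∷ R , S , refl , grow cR 1∈P₀ , cS

-- Descent-injective shapes

DescentInjective : Comp → Set
DescentInjective α = ∀ {T T′} → Chain T α → Chain T′ α → descents T ≡ descents T′ → T ≡ T′

length≤1 : ∀ {A : Set} {xs : List A} → Unique xs → (∀ {x y} → x ∈ xs → y ∈ xs → x ≡ y) → length xs ≤ 1
length≤1 {xs = []}                       _ _    = z≤n
length≤1 {xs = _ ∷ []}                   _ _    = s≤s z≤n
length≤1 {xs = _ ∷ _ ∷ _} ((x≢y ∷ _) ∷ _) same = contradiction (same (here refl) (there (here refl))) x≢y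

DescentInjective⇒FMultFree : ∀ {α} → DescentInjective α → FMultFree α
DescentInjective⇒FMultFree {α} inj β = length≤1 (AllPairs.filter⁺ hasCom? (SCT-unique α)) same
  where
  hasCom? : ∀ T → Dec (com T ≡ β)
  hasCom? T = ≡-dec _≟_ (com T) β
  same : ∀ {T T′} → T ∈ filter hasCom? (SCT α) → T′ ∈ filter hasCom? (SCT α) → T ≡ T′
  same T∈ T′∈ with ∈-filter⁻ hasCom? T∈ | ∈-filter⁻ hasCom? T′∈
  ... | T∈SCT , comT≡β | T′∈SCT , comT′≡β =
    inj (∈-SCT⁻ T∈SCT) (∈-SCT⁻ T′∈SCT) (com≡⇒descents≡ (trans comT≡β (sym comT′≡β)))

DescentInjective-++-1∷ : ∀ P {Q} → All (_≤ 2) (P ++ 1 ∷ Q) →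
  DescentInjective P → DescentInjective Q → DescentInjective (P ++ 1 ∷ Q)
DescentInjective-++-1∷ P {Q} α≤2 injP injQ c c′ eq
  with Chain-split c α≤2 P Q refl | Chain-split c′ α≤2 P Q refl
... | R , S , refl , cR , cS | R′ , S′ , refl , cR′ , cS′ =
  let eqR , eq1S = descents-++⁻ R (trans (Chain⇒length≡sum cR) (sym (Chain⇒length≡sum cR′))) eq
  in cong₂ _++_ (injP cR cR′ eqR) (cong (1 ∷_) (injQ cS cS′ (descents-∷⁻ eq1S)))

DescentsSeparate : List (List ℕ) → Set
DescentsSeparate Ts = All (λ T → All (λ T′ → descents T ≡ descents T′ → T ≡ T′) Ts) Ts

descentsSeparate? : ∀ Ts → Dec (DescentsSeparate Ts)
descentsSeparate? Ts =
  All.all? (λ T → All.all? (λ T′ → ≡-dec Bool._≟_ (descents T) (descents T′) →-dec ≡-dec _≟_ T T′) Ts) Ts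

DescentsSeparate⇒DescentInjective : ∀ {α} → DescentsSeparate (SCT α) → DescentInjective α
DescentsSeparate⇒DescentInjective sep c c′ = All.lookup (All.lookup sep (∈-SCT⁺ c)) (∈-SCT⁺ c′)

DescentInjective-twos : ∀ {e} → e ≤ 4 → DescentInjective (replicate e 2)
DescentInjective-twos e≤4 = DescentsSeparate⇒DescentInjective (byEvaluation e≤4)
  where
  byEvaluation : ∀ {e} → e ≤ 4 → DescentsSeparate (SCT (replicate e 2))
  byEvaluation z≤n                               = toWitness {a? = descentsSeparate? _} _
  byEvaluation (s≤s z≤n)                         = toWitness {a? = descentsSeparate? _} _
  byEvaluation (s≤s (s≤s z≤n))                   = toWitness {a? = descentsSeparate? _} _
  byEvaluation (s≤s (s≤s (s≤s z≤n)))             = toWitness {a? = descentsSeparate? _} _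
  byEvaluation (s≤s (s≤s (s≤s (s≤s z≤n))))       = toWitness {a? = descentsSeparate? _} _

data ShortTwoRuns : Comp → Set where
  twos    : ∀ {e} → e ≤ 4 → ShortTwoRuns (replicate e 2)
  twos-1∷ : ∀ {e Q} → e ≤ 4 → ShortTwoRuns Q → ShortTwoRuns (replicate e 2 ++ 1 ∷ Q)

ShortTwoRuns-ones : ∀ f {Q} → ShortTwoRuns Q → ShortTwoRuns (replicate f 1 ++ Q)
ShortTwoRuns-ones zero    r = r
ShortTwoRuns-ones (suc f) r = twos-1∷ z≤n (ShortTwoRuns-ones f r)

ShortTwoRuns⇒≤2 : ∀ {α} → ShortTwoRuns α → All (_≤ 2) α
ShortTwoRuns⇒≤2 (twos {e} _)      = All.replicate⁺ e ≤-refl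
ShortTwoRuns⇒≤2 (twos-1∷ {e} _ r) = All.++⁺ (All.replicate⁺ e ≤-refl) (s≤s z≤n ∷ ShortTwoRuns⇒≤2 r)

ShortTwoRuns⇒DescentInjective : ∀ {α} → ShortTwoRuns α → DescentInjective α
ShortTwoRuns⇒DescentInjective (twos e≤4)                 = DescentInjective-twos e≤4
ShortTwoRuns⇒DescentInjective r@(twos-1∷ {e} e≤4 r′) =
  DescentInjective-++-1∷ (replicate e 2) (ShortTwoRuns⇒≤2 r) (DescentInjective-twos e≤4) (ShortTwoRuns⇒DescentInjective r′)

-- Shapes containing 2⁵

row : ∀ r → Chain (applyDownFrom suc (suc r)) [ suc r ]
row zero    = top ∅
row (suc r) = subst (Chain _) (incLeftmost-head (suc r) []) (grow (row r) (here refl))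

chainOf : ∀ {α} → All (0 <_) α → ∃ λ T → Chain T α
chainOf []                      = [] , ∅
chainOf {suc r ∷ α} (_ ∷ α>0) = let T , c = chainOf α>0 in applyDownFrom suc (suc r) ++ T , Chain-++ (row r) c

T₁ T₂ : List ℕ
T₁ = 2 ∷ 2 ∷ 1 ∷ 2 ∷ 2 ∷ 1 ∷ 1 ∷ 2 ∷ 1 ∷ 1 ∷ []
T₂ = 2 ∷ 2 ∷ 1 ∷ 1 ∷ 2 ∷ 1 ∷ 2 ∷ 2 ∷ 1 ∷ 1 ∷ []

chain-T₁ : Chain T₁ (replicate 5 2)
chain-T₁ = ∈-SCT⁻ (toWitness {a? = T₁ ∈? SCT (replicate 5 2)} _)

chain-T₂ : Chain T₂ (replicate 5 2)
chain-T₂ = ∈-SCT⁻ (toWitness {a? = T₂ ∈? SCT (replicate 5 2)} _)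

2≤length : ∀ {A : Set} {xs : List A} {x y} → x ∈ xs → y ∈ xs → x ≢ y → 2 ≤ length xs
2≤length (here refl) (here refl) x≢y = contradiction refl x≢y
2≤length (here refl) (there y∈)  _   = s≤s (∈-length y∈)
2≤length (there x∈)  (here refl) _   = s≤s (∈-length x∈)
2≤length (there x∈)  (there y∈)  x≢y = ≤-trans (2≤length x∈ y∈ x≢y) (n≤1+n _)

-- T₁ and T₂ have the same descents, first letter and last letter, so com cannot tell them
-- apart after tableaux of the rows above and below are attached.
¬FMultFree-twos⁵ : ∀ X Y → All (0 <_) X → All (0 <_) Y → ¬ FMultFree (X ++ replicate 5 2 ++ Y)
¬FMultFree-twos⁵ X Y X>0 Y>0 free with chainOf X>0 | chainOf Y>0
... | TX , cX | TY , cY = contradiction (≤-trans (2≤length U₁∈ U₂∈ U₁≢U₂) (free (com U₁))) λ { (s≤s ()) }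
  where
  α : Comp
  α = X ++ replicate 5 2 ++ Y
  U₁ U₂ : List ℕ
  U₁ = TX ++ T₁ ++ TY
  U₂ = TX ++ T₂ ++ TY
  hasCom? : ∀ T → Dec (com T ≡ com U₁)
  hasCom? T = ≡-dec _≟_ (com T) (com U₁)
  U₁∈ : U₁ ∈ filter hasCom? (SCT α)
  U₁∈ = ∈-filter⁺ hasCom? (∈-SCT⁺ (Chain-++ cX (Chain-++ chain-T₁ cY))) refl
  U₂∈ : U₂ ∈ filter hasCom? (SCT α)
  U₂∈ = ∈-filter⁺ hasCom? (∈-SCT⁺ (Chain-++ cX (Chain-++ chain-T₂ cY))) (com-++-cong TX refl)
  U₁≢U₂ : U₁ ≢ U₂
  U₁≢U₂ eq with ++-cancelˡ TX _ _ eq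
  ... | ()

¬FMultFree-twos : ∀ X {e} Y → 4 < e → All (0 <_) (X ++ replicate e 2 ++ Y) → ¬ FMultFree (X ++ replicate e 2 ++ Y)
¬FMultFree-twos X {suc (suc (suc (suc (suc j))))} Y (s≤s (s≤s (s≤s (s≤s (s≤s _))))) α>0 =
  ¬FMultFree-twos⁵ X (replicate j 2 ++ Y) (All.++⁻ˡ X α>0) (All.++⁻ʳ (replicate 5 2) (All.++⁻ʳ X α>0))

InteriorPositive : ∀ {m} → Vec ℕ (suc m) → Set
InteriorPositive {m} f = (i : Fin (suc m)) → 0 < toℕ i → toℕ i < m → 1 ≤ lookup f i

InteriorPositive-tail : ∀ {m} {x x₂ x′} {fs : Vec ℕ m} → InteriorPositive (x ∷ x₂ ∷ fs) → InteriorPositive (x′ ∷ fs)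
InteriorPositive-tail f⁺ (suc i) _ i<m = f⁺ (suc (suc i)) (s≤s z≤n) (s≤s i<m)

alphaShape-suc : ∀ {m} x (fs : Vec ℕ m) es → alphaShape (suc x ∷ fs) es ≡ 1 ∷ alphaShape (x ∷ fs) es
alphaShape-suc x []      []      = refl
alphaShape-suc x (_ ∷ _) (_ ∷ _) = refl

alphaShape-ShortTwoRuns : ∀ {m} (f : Vec ℕ (suc m)) (e : Vec ℕ m) →
  InteriorPositive f → ((i : Fin m) → lookup e i ≤ 4) → ShortTwoRuns (alphaShape f e)
alphaShape-ShortTwoRuns (x ∷ []) [] _ _ =
  subst ShortTwoRuns (++-identityʳ _) (ShortTwoRuns-ones x (twos z≤n))
alphaShape-ShortTwoRuns (x ∷ 0 ∷ []) (y ∷ []) _ e≤4 =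
  ShortTwoRuns-ones x (subst ShortTwoRuns (sym (++-identityʳ _)) (twos (e≤4 zero)))
alphaShape-ShortTwoRuns (x ∷ 0 ∷ _ ∷ _) (_ ∷ _ ∷ _) f⁺ _ = contradiction (f⁺ (suc zero) (s≤s z≤n) (s≤s (s≤s z≤n))) λ ()
alphaShape-ShortTwoRuns (x ∷ suc x₂ ∷ fs) (y ∷ es) f⁺ e≤4 =
  ShortTwoRuns-ones x (subst (λ α → ShortTwoRuns (replicate y 2 ++ α)) (sym (alphaShape-suc x₂ fs es))
    (twos-1∷ (e≤4 zero) (alphaShape-ShortTwoRuns (x₂ ∷ fs) es (InteriorPositive-tail f⁺) (e≤4 ∘ suc))))

alphaShape-positive : ∀ {m} (f : Vec ℕ (suc m)) (e : Vec ℕ m) → All (0 <_) (alphaShape f e)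
alphaShape-positive (x ∷ [])      []       = All.replicate⁺ x (s≤s z≤n)
alphaShape-positive (x ∷ x₂ ∷ fs) (y ∷ es) =
  All.++⁺ (All.replicate⁺ x (s≤s z≤n)) (All.++⁺ (All.replicate⁺ y (s≤s z≤n)) (alphaShape-positive (x₂ ∷ fs) es))

alphaShape-twos : ∀ {m} (f : Vec ℕ (suc m)) (e : Vec ℕ m) (i : Fin m) →
  ∃₂ λ X Y → alphaShape f e ≡ X ++ replicate (lookup e i) 2 ++ Y
alphaShape-twos (x ∷ x₂ ∷ fs) (y ∷ es) zero    = replicate x 1 , alphaShape (x₂ ∷ fs) es , refl
alphaShape-twos (x ∷ x₂ ∷ fs) (y ∷ es) (suc i) with alphaShape-twos (x₂ ∷ fs) es i
... | X , Y , eq = replicate x 1 ++ replicate y 2 ++ X , Y , (begin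
  replicate x 1 ++ replicate y 2 ++ alphaShape (x₂ ∷ fs) es  ≡⟨ cong (λ α → replicate x 1 ++ replicate y 2 ++ α) eq ⟩
  replicate x 1 ++ replicate y 2 ++ X ++ Z                   ≡⟨ cong (replicate x 1 ++_) (++-assoc (replicate y 2) X Z) ⟨
  replicate x 1 ++ (replicate y 2 ++ X) ++ Z                 ≡⟨ ++-assoc (replicate x 1) (replicate y 2 ++ X) Z ⟨
  (replicate x 1 ++ replicate y 2 ++ X) ++ Z                 ∎)
  where
  open ≡-Reasoning
  Z : Comp
  Z = replicate (lookup es i) 2 ++ Y

alphaShape-FMultFree⇒twos≤4 : ∀ {m} (f : Vec ℕ (suc m)) (e : Vec ℕ m) →
  FMultFree (alphaShape f e) → (i : Fin m) → lookup e i ≤ 4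
alphaShape-FMultFree⇒twos≤4 f e free i with lookup e i ≤? 4
... | yes e≤4 = e≤4
... | no  e≰4 with alphaShape-twos f e i
...   | X , Y , eq = contradiction (subst FMultFree eq free)
        (¬FMultFree-twos X Y (≰⇒> e≰4) (subst (All (0 <_)) eq (alphaShape-positive f e)))

corollary6p3 : (m : ℕ) (f : Vec ℕ (suc m)) (e : Vec ℕ m)
    → ((i : Fin (suc m)) → 0 < toℕ i → toℕ i < m → 1 ≤ lookup f i)
    → ((i : Fin m) → 1 ≤ lookup e i)
    → (FMultFree (alphaShape f e) → (i : Fin m) → lookup e i ≤ 4)
      × (((i : Fin m) → lookup e i ≤ 4) → FMultFree (alphaShape f e))
corollary6p3 m f e f⁺ _ =
  alphaShape-FMultFree⇒twos≤4 f e ,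
  λ e≤4 → DescentInjective⇒FMultFree (ShortTwoRuns⇒DescentInjective (alphaShape-ShortTwoRuns f e f⁺ e≤4))
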